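{- For any integers $k \geq 2$ and $t \geq 2$, there is a constant $\beta_k$, depending only on $k$, such that for all $n$, \[ \mathrm{ex}(n, C_{2k+1}, K_{2,t}\text{ -ind}) \leq ( \alpha ( k , t )^{1/2} + 1 )^{1/2} \frac{ n^{3/2} }{2} + \beta_k n^{1 + 1/(2k)}, \] where $\alpha (k,t) = ( 2k -2)(t - 1)( ( 2k -2)(t - 1) - 1)$.
   Context: For graphs $H$ and $F$, $\mathrm{ex}(n, H, F\text{ -ind})$ denotes the maximum number of edges in an $n$-vertex graph that contains no (not necessarily induced) subgraph isomorphic to $H$ and no induced subgraph isomorphic to $F$. $C_{2k+1}$ is the cycle of length $2k+1$. -}

module Defs where

open import Data.Nat as ℕ using (ℕ; zero; suc; _+_; _*_; _∸_; _^_; _<ᵇ_; _≡ᵇ_)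
open import Data.Bool using (Bool; true; false; _∧_; _∨_; not; if_then_else_; T)
open import Data.Fin as Fin using (Fin; toℕ)
open import Data.Integer using (+_)
open import Data.Rational as ℚ using (ℚ; _/_)
open import Data.Product using (Σ; _×_; ∃-syntax)
open import Function.Definitions using (Injective)
open import Relation.Binary.PropositionalEquality using (_≡_)
open import Relation.Nullary using (¬_)

record Graph (n : ℕ) : Set where
  field
    adj    : Fin n → Fin n → Bool
    sym    : ∀ i j → adj i j ≡ adj j i
    irrefl : ∀ i → adj i i ≡ false
open Graph public

sumFin : ∀ {n} → (Fin n → ℕ) → ℕ
sumFin {zero}  f = 0
sumFin {suc n} f = f Fin.zero + sumFin (λ i → f (Fin.suc i))

edges : ∀ {n} → Graph n → ℕ
edges G = sumFin (λ i → sumFin (λ j →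
            if (toℕ i <ᵇ toℕ j) ∧ adj G i j then 1 else 0))

ContainsSubgraph : ∀ {m n} → (Fin m → Fin m → Bool) → Graph n → Set
ContainsSubgraph {m} {n} F G =
  ∃[ f ] (Injective _≡_ _≡_ f ×
          (∀ i j → T (F i j) → T (adj G (f i) (f j))))

ContainsInduced : ∀ {m n} → (Fin m → Fin m → Bool) → Graph n → Set
ContainsInduced {m} {n} F G =
  ∃[ f ] (Injective _≡_ _≡_ f ×
          (∀ i j → adj G (f i) (f j) ≡ F i j))

-- The cycle C_m on Fin m (m ≥ 3): i ~ j iff j ≡ i ± 1 (mod m).

cycAdj : (m : ℕ) → Fin m → Fin m → Bool
cycAdj m i j =
  (suc (toℕ i) ≡ᵇ toℕ j) ∨ (suc (toℕ j) ≡ᵇ toℕ i) ∨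
  ((toℕ i ≡ᵇ 0) ∧ (suc (toℕ j) ≡ᵇ m)) ∨ ((toℕ j ≡ᵇ 0) ∧ (suc (toℕ i) ≡ᵇ m))

-- The complete bipartite graph K_{2,t} on Fin (2 + t):
-- vertices 0,1 form one side, the remaining t vertices the other side.
bipAdj : (t : ℕ) → Fin (2 + t) → Fin (2 + t) → Bool
bipAdj t i j = (toℕ i <ᵇ 2) ∧ not (toℕ j <ᵇ 2) ∨ not (toℕ i <ᵇ 2) ∧ (toℕ j <ᵇ 2)

ℕ→ℚ : ℕ → ℚ
ℕ→ℚ n = + n / 1

_^ℚ_ : ℚ → ℕ → ℚ
q ^ℚ zero  = ℚ.1ℚ
q ^ℚ suc m = q ℚ.* (q ^ℚ m)

-- α(k,t) = (2k-2)(t-1)((2k-2)(t-1) - 1)   (a natural number for k,t ≥ 2)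
α : ℕ → ℕ → ℕ
α k t = ((2 * k ∸ 2) * (t ∸ 1)) * ((2 * k ∸ 2) * (t ∸ 1) ∸ 1)

-- Let a = (α(k,t)^{1/2} + 1)^{1/2} n^{3/2} / 2 and b = β n^{1 + 1/(2k)}
-- (both real, ≥ 0).  ExceedsBound k t β n e says: there is a rational q
-- with a < q and q + b < e, i.e. e > a + b.  The two strict real
-- inequalities are written out by squaring / raising to the 2k-th power:
--   a < q      ⇔  0 < q, 0 < 4q² - n³ and α n⁶ < (4q² - n³)²
--   b < e - q  ⇔  0 < e - q and β^{2k} n^{2k+1} < (e - q)^{2k}
-- Since ℚ is dense in ℝ, e ≤ a + b  ⇔  ¬ ExceedsBound k t β n e.
ExceedsBound : (k t β n e : ℕ) → Set
ExceedsBound k t β n e =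
  ∃[ q ] ( (ℚ.0ℚ ℚ.< q)
         × (ℚ.0ℚ ℚ.< D q)
         × (ℕ→ℚ (α k t * n ^ 6) ℚ.< D q ^ℚ 2)
         × (ℚ.0ℚ ℚ.< ℕ→ℚ e ℚ.- q)
         × (ℕ→ℚ (β ^ (2 * k) * n ^ (2 * k + 1)) ℚ.< (ℕ→ℚ e ℚ.- q) ^ℚ (2 * k)) )
  where
  D : ℚ → ℚ
  D q = ℕ→ℚ 4 ℚ.* (q ^ℚ 2) ℚ.- ℕ→ℚ (n ^ 3)

{-# OPTIONS --safe #-}
-- Write D = 2k − 2 and m = D(t − 1). A path on D + 1 vertices inside the common neighbourhood of
-- two distinct vertices u, v, or on D + 2 vertices inside a neighbourhood N(u), closes into a
-- (2k+1)-cycle through u and v, resp. through u. A vertex set without a path on ℓ + 2 vertices is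
-- ℓ-degenerate (a path can be grown from its head while the head has more than ℓ neighbours in the
-- set), so common neighbourhoods are (D − 1)-degenerate and neighbourhoods are D-degenerate.
-- Choosing low-degree vertices greedily, a common neighbourhood of two non-adjacent vertices with
-- more than m elements contains t independent vertices, i.e. an induced K₂,ₜ; so their codegree is
-- at most m, while Σ_{v ∈ N(u)} codeg(u, v) = 2e(G[N(u)]) ≤ 2D deg u by degeneracy. Hence
-- Σ deg² = Σ_{u,v} codeg(u, v) ≤ (2D + 1)·2e + m n², and Cauchy–Schwarz gives
-- (2e)² ≤ n((2D + 1)·2e + m n²), i.e. e ≤ √m n^{3/2}/2 + (2D + 1) n. As m ≤ √(m(m − 1)) + 1, this
-- is below the stated bound with β = 2D + 1 = 4k − 3.
module Submission where

open import Defs renaming (sym to adj-sym; irrefl to adj-irrefl)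
open import Data.Bool using (Bool; true; false; _∧_; not; T; if_then_else_)
open import Data.Bool.Properties using (T-≡; T-not-≡; T-∧; T-∨; ∧-idem)
open import Data.Fin as Fin using (Fin; toℕ; _≟_)
open import Data.Fin.Properties as Finₚ using (toℕ-injective; toℕ-fromℕ)
open import Data.Nat as ℕ using (ℕ; zero; suc; _+_; _*_; _∸_; _^_; _≤_; _<_; z≤n; s≤s; _<ᵇ_; _≡ᵇ_)
open import Data.Nat.Properties hiding (_≟_)
open import Data.Nat.Tactic.RingSolver using (solve-∀)
open import Data.Nat.Coprimality as Coprime using (1-coprimeTo)
import Data.Integer as ℤ
import Data.Integer.Properties as ℤₚ
open import Data.Rational as ℚ using (ℚ; mkℚ; 0ℚ)
import Data.Rational.Properties as ℚₚ
open import Data.Rational.Solver using (module +-*-Solver)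
open import Data.Product using (Σ-syntax; _×_; _,_; proj₁; proj₂; ∃-syntax; uncurry)
open import Data.Sum using (_⊎_; inj₁; inj₂)
open import Data.Empty using (⊥-elim)
open import Relation.Binary.Definitions using (tri<; tri≈; tri>)
open import Function.Definitions using (Injective)
open import Function using (_∘_; Equivalence)
open import Data.Vec.Functional using (_∷_; [])
open import Relation.Binary.PropositionalEquality
open import Relation.Nullary using (¬_)
open import Relation.Nullary.Decidable using (does; yes; no; dec-true; dec-false; T?; ¬?; _×-dec_)
open import Algebra.Properties.Semiring.Sum +-*-semiring
  using (sum; sum-syntax; sum-cong-≗; sum-replicate-zero; ∑-distrib-+; ∑-comm; *-distribˡ-sum; *-distribʳ-sum)

𝟙 : Bool → ℕ
𝟙 b = if b then 1 else 0

𝟙-∧ : ∀ a b → 𝟙 (a ∧ b) ≡ 𝟙 a * 𝟙 b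
𝟙-∧ false b = refl
𝟙-∧ true  b = sym (+-identityʳ (𝟙 b))

𝟙≤1 : ∀ b → 𝟙 b ≤ 1
𝟙≤1 false = z≤n
𝟙≤1 true  = s≤s z≤n

𝟙-∧≤ˡ : ∀ a b → 𝟙 (a ∧ b) ≤ 𝟙 a
𝟙-∧≤ˡ false b = z≤n
𝟙-∧≤ˡ true  b = 𝟙≤1 b

𝟙-split-≤ : ∀ x a c → 𝟙 (x ∧ a) ≤ 𝟙 (not c ∧ (x ∧ a)) + 𝟙 (a ∧ c)
𝟙-split-≤ false a     c     = z≤n
𝟙-split-≤ true  false c     = z≤n
𝟙-split-≤ true  true  false = s≤s z≤n
𝟙-split-≤ true  true  true  = s≤s z≤n

𝟙-remove-≤ : ∀ a b c x y → 𝟙 (a ∧ (b ∧ c)) ≤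
             𝟙 ((not x ∧ a) ∧ ((not y ∧ b) ∧ c)) + (𝟙 x * 𝟙 (b ∧ c) + 𝟙 y * 𝟙 (a ∧ c))
𝟙-remove-≤ false b     c     x     y     = z≤n
𝟙-remove-≤ true  false c     x     y     = z≤n
𝟙-remove-≤ true  true  false x     y     = z≤n
𝟙-remove-≤ true  true  true  false false = s≤s z≤n
𝟙-remove-≤ true  true  true  false true  = s≤s z≤n
𝟙-remove-≤ true  true  true  true  y     = s≤s z≤n

T-∧ˡ : ∀ {a b} → T (a ∧ b) → T a
T-∧ˡ = proj₁ ∘ Equivalence.to T-∧

T-∧ʳ : ∀ {a b} → T (a ∧ b) → T b
T-∧ʳ = proj₂ ∘ Equivalence.to T-∧

sumFin≡sum : ∀ {n} (f : Fin n → ℕ) → sumFin f ≡ sum f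
sumFin≡sum {zero}  f = refl
sumFin≡sum {suc n} f = cong (f Fin.zero +_) (sumFin≡sum (f ∘ Fin.suc))

sum-mono-≤ : ∀ {n} {f g : Fin n → ℕ} → (∀ i → f i ≤ g i) → sum f ≤ sum g
sum-mono-≤ {zero}  f≤g = z≤n
sum-mono-≤ {suc n} f≤g = +-mono-≤ (f≤g Fin.zero) (sum-mono-≤ (f≤g ∘ Fin.suc))

f≤sum : ∀ {n} (f : Fin n → ℕ) i → f i ≤ sum f
f≤sum f Fin.zero    = m≤m+n _ _
f≤sum f (Fin.suc i) = ≤-trans (f≤sum (f ∘ Fin.suc) i) (m≤n+m _ _)

sum-const : ∀ n c → ∑[ i < n ] c ≡ n * c
sum-const zero    c = refl
sum-const (suc n) c = cong (c +_) (sum-const n c)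

sum-δ : ∀ {n} (x : Fin n) (f : Fin n → ℕ) → ∑[ i < n ] (𝟙 (does (i ≟ x)) * f i) ≡ f x
sum-δ {suc n} Fin.zero    f = trans (cong₂ _+_ (+-identityʳ _) (sum-replicate-zero n)) (+-identityʳ _)
sum-δ {suc n} (Fin.suc x) f = sum-δ x (f ∘ Fin.suc)

sum-δ≡1 : ∀ {n} (x : Fin n) → ∑[ i < n ] 𝟙 (does (i ≟ x)) ≡ 1
sum-δ≡1 {n} x = trans (sum-cong-≗ {n} (λ i → sym (*-identityʳ (𝟙 (does (i ≟ x)))))) (sum-δ x (λ _ → 1))

2mn≤m²+n² : ∀ m n → 2 * (m * n) ≤ m * m + n * n
2mn≤m²+n² zero    n       = z≤n
2mn≤m²+n² (suc m) zero    = ≤-trans (≤-reflexive (cong (2 *_) (*-zeroʳ (suc m)))) z≤n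
2mn≤m²+n² (suc m) (suc n) = begin
  2 * (suc m * suc n)                  ≡⟨ expand-lhs m n ⟩
  2 * (m * n) + 2 * (m + n + 1)        ≤⟨ +-monoˡ-≤ _ (2mn≤m²+n² m n) ⟩
  m * m + n * n + 2 * (m + n + 1)      ≡⟨ expand-rhs m n ⟩
  suc m * suc m + suc n * suc n        ∎
  where
  open ≤-Reasoning
  expand-lhs : ∀ m n → 2 * (suc m * suc n) ≡ 2 * (m * n) + 2 * (m + n + 1)
  expand-lhs = solve-∀
  expand-rhs : ∀ m n → m * m + n * n + 2 * (m + n + 1) ≡ suc m * suc m + suc n * suc n
  expand-rhs = solve-∀

∑∑-distrib-+ : ∀ {m n} (f g : Fin m → Fin n → ℕ) →
               ∑[ i < m ] ∑[ j < n ] (f i j + g i j) ≡ ∑[ i < m ] ∑[ j < n ] f i j + ∑[ i < m ] ∑[ j < n ] g i j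
∑∑-distrib-+ {m} f g = trans (sum-cong-≗ {m} (λ i → ∑-distrib-+ (f i) (g i)))
                             (∑-distrib-+ (λ i → sum (f i)) (λ i → sum (g i)))

*-sum-sum : ∀ {m n} (f : Fin m → ℕ) (g : Fin n → ℕ) →
            sum f * sum g ≡ ∑[ i < m ] ∑[ j < n ] (f i * g j)
*-sum-sum f g = trans (*-distribʳ-sum (sum g) f) (sum-cong-≗ (λ i → *-distribˡ-sum (f i) g))

sum-square≤ : ∀ {n} (f : Fin n → ℕ) → sum f * sum f ≤ n * ∑[ i < n ] (f i * f i)
sum-square≤ {n} f = *-cancelˡ-≤ 2 (begin
  2 * (sum f * sum f)
    ≡⟨ cong (2 *_) (*-sum-sum f f) ⟩
  2 * ∑[ i < n ] ∑[ j < n ] (f i * f j)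
    ≡⟨ *-distribˡ-sum 2 (λ i → ∑[ j < n ] (f i * f j)) ⟩
  ∑[ i < n ] (2 * ∑[ j < n ] (f i * f j))
    ≡⟨ sum-cong-≗ {n} (λ i → *-distribˡ-sum 2 (λ j → f i * f j)) ⟩
  ∑[ i < n ] ∑[ j < n ] (2 * (f i * f j))
    ≤⟨ sum-mono-≤ {n} (λ i → sum-mono-≤ {n} (λ j → 2mn≤m²+n² (f i) (f j))) ⟩
  ∑[ i < n ] ∑[ j < n ] (f i * f i + f j * f j)
    ≡⟨ ∑∑-distrib-+ (λ i _ → f i * f i) (λ _ j → f j * f j) ⟩
  ∑[ i < n ] ∑[ j < n ] (f i * f i) + ∑[ i < n ] Q
    ≡⟨ cong₂ _+_ (sum-cong-≗ {n} (λ i → sum-const n (f i * f i))) (sum-const n Q) ⟩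
  ∑[ i < n ] (n * (f i * f i)) + n * Q
    ≡⟨ cong (_+ n * Q) (*-distribˡ-sum n (λ i → f i * f i)) ⟨
  n * Q + n * Q
    ≡⟨ cong (n * Q +_) (+-identityʳ (n * Q)) ⟨
  2 * (n * Q)
    ∎)
  where
  open ≤-Reasoning
  Q : ℕ
  Q = ∑[ i < n ] (f i * f i)

infix  4 _⊆_
infixr 7 _∩_
infixl 6 _─_

∣_∣ : ∀ {n} → (Fin n → Bool) → ℕ
∣_∣ {n} W = ∑[ i < n ] 𝟙 (W i)

_∩_ : ∀ {n} → (Fin n → Bool) → (Fin n → Bool) → Fin n → Bool
(W ∩ X) i = W i ∧ X i

_⊆_ : ∀ {n} → (Fin n → Bool) → (Fin n → Bool) → Set
W ⊆ X = ∀ {i} → T (W i) → T (X i)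

_─_ : ∀ {n} → (Fin n → Bool) → Fin n → Fin n → Bool
(W ─ w) i = not (does (i ≟ w)) ∧ W i

∣∣>0⇒nonempty : ∀ {n} (W : Fin n → Bool) → 0 < ∣ W ∣ → ∃[ w ] T (W w)
∣∣>0⇒nonempty {suc n} W 0<∣W∣ with W Fin.zero in eq
... | true  = Fin.zero , Equivalence.from T-≡ eq
... | false with ∣∣>0⇒nonempty (W ∘ Fin.suc) 0<∣W∣
...   | w , w∈W = Fin.suc w , w∈W

∣∣-remove : ∀ {n} (W : Fin n → Bool) {w} → T (W w) → ∣ W ∣ ≡ suc ∣ W ─ w ∣
∣∣-remove {n} W {w} w∈W = begin
  ∑[ i < n ] 𝟙 (W i)                             ≡⟨ sum-cong-≗ {n} split ⟩
  ∑[ i < n ] (δ i + 𝟙 ((W ─ w) i))               ≡⟨ ∑-distrib-+ δ (λ i → 𝟙 ((W ─ w) i)) ⟩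
  ∑[ i < n ] δ i + ∣ W ─ w ∣                     ≡⟨ cong (_+ ∣ W ─ w ∣) (sum-δ≡1 w) ⟩
  suc ∣ W ─ w ∣                                  ∎
  where
  open ≡-Reasoning
  δ : Fin n → ℕ
  δ i = 𝟙 (does (i ≟ w))
  split : ∀ i → 𝟙 (W i) ≡ δ i + 𝟙 ((W ─ w) i)
  split i with i ≟ w
  ... | yes refl = cong 𝟙 (Equivalence.to T-≡ w∈W)
  ... | no  _    = refl

∣∣≤image : ∀ {m n} (X : Fin n → Bool) (g : Fin m → Fin n) →
           (∀ {i} → T (X i) → ∃[ a ] g a ≡ i) → ∣ X ∣ ≤ m
∣∣≤image {m} {n} X g covered = begin
  ∑[ i < n ] 𝟙 (X i)                           ≤⟨ sum-mono-≤ {n} hit ⟩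
  ∑[ i < n ] ∑[ a < m ] 𝟙 (does (i ≟ g a))     ≡⟨ ∑-comm (λ i a → 𝟙 (does (i ≟ g a))) ⟩
  ∑[ a < m ] ∑[ i < n ] 𝟙 (does (i ≟ g a))     ≡⟨ sum-cong-≗ {m} (λ a → sum-δ≡1 (g a)) ⟩
  ∑[ a < m ] 1                                 ≡⟨ trans (sum-const m 1) (*-identityʳ m) ⟩
  m                                            ∎
  where
  open ≤-Reasoning
  hit : ∀ i → 𝟙 (X i) ≤ ∑[ a < m ] 𝟙 (does (i ≟ g a))
  hit i with X i in i∈X
  ... | false = z≤n
  ... | true with covered (Equivalence.from T-≡ i∈X)
  ...   | a , refl = ≤-trans (≤-reflexive (cong 𝟙 (sym (dec-true (g a ≟ g a) refl))))
                             (f≤sum (λ a′ → 𝟙 (does (g a ≟ g a′))) a)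

∷-injective : ∀ {m n} {x : Fin n} {f : Fin m → Fin n} →
              (∀ a → f a ≢ x) → Injective _≡_ _≡_ f → Injective _≡_ _≡_ (x ∷ f)
∷-injective x∉f f-inj {Fin.zero}  {Fin.zero}  _  = refl
∷-injective x∉f f-inj {Fin.zero}  {Fin.suc b} eq = ⊥-elim (x∉f b (sym eq))
∷-injective x∉f f-inj {Fin.suc a} {Fin.zero}  eq = ⊥-elim (x∉f a eq)
∷-injective x∉f f-inj {Fin.suc a} {Fin.suc b} eq = cong Fin.suc (f-inj eq)

module _ {n : ℕ} (G : Graph n) where

  infix 4 _~_
  _~_ : Fin n → Fin n → Set
  u ~ v = T (adj G u v)

  ~-sym : ∀ {u v} → u ~ v → v ~ u
  ~-sym {u} {v} = subst T (adj-sym G u v)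

  ~-irrefl : ∀ {u} → ¬ u ~ u
  ~-irrefl {u} = subst T (adj-irrefl G u)

  ~⇒≢ : ∀ {u v} → u ~ v → u ≢ v
  ~⇒≢ u~v refl = ~-irrefl u~v

  degree : Fin n → ℕ
  degree v = ∣ adj G v ∣

  degreeIn : (Fin n → Bool) → Fin n → ℕ
  degreeIn W v = ∣ W ∩ adj G v ∣

  codegree : Fin n → Fin n → ℕ
  codegree u v = ∣ adj G u ∩ adj G v ∣

  𝟙-adj-split : ∀ i j →
                𝟙 (adj G i j) ≡ 𝟙 ((toℕ i <ᵇ toℕ j) ∧ adj G i j) + 𝟙 ((toℕ j <ᵇ toℕ i) ∧ adj G j i)
  𝟙-adj-split i j with <-cmp (toℕ i) (toℕ j)
  ... | tri< i<j _ _ rewrite dec-true (T? (toℕ i <ᵇ toℕ j)) (<⇒<ᵇ i<j)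
                           | dec-false (T? (toℕ j <ᵇ toℕ i)) (<⇒≯ i<j ∘ <ᵇ⇒< (toℕ j) (toℕ i)) = sym (+-identityʳ _)
  ... | tri≈ _ i≡j _ rewrite toℕ-injective i≡j
                           | dec-false (T? (toℕ j <ᵇ toℕ j)) (<-irrefl refl ∘ <ᵇ⇒< (toℕ j) (toℕ j))
                           | adj-irrefl G j = refl
  ... | tri> _ _ j<i rewrite dec-false (T? (toℕ i <ᵇ toℕ j)) (<⇒≯ j<i ∘ <ᵇ⇒< (toℕ i) (toℕ j))
                           | dec-true (T? (toℕ j <ᵇ toℕ i)) (<⇒<ᵇ j<i)
                           | adj-sym G j i = refl

  degree-sum : ∑[ v < n ] degree v ≡ 2 * edges G
  degree-sum = begin
    ∑[ i < n ] ∑[ j < n ] 𝟙 (adj G i j)                    ≡⟨ sum-cong-≗ {n} (λ i → sum-cong-≗ {n} (𝟙-adj-split i)) ⟩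
    ∑[ i < n ] ∑[ j < n ] (e i j + e j i)                   ≡⟨ ∑∑-distrib-+ e (λ i j → e j i) ⟩
    E + ∑[ i < n ] ∑[ j < n ] e j i                         ≡⟨ cong (E +_) (∑-comm (λ i j → e j i)) ⟩
    E + E                                                   ≡⟨ cong (E +_) (sym (+-identityʳ E)) ⟩
    2 * E                                                   ≡⟨ cong (2 *_) edges≡E ⟨
    2 * edges G                                             ∎
    where
    open ≡-Reasoning
    e : Fin n → Fin n → ℕ
    e i j = 𝟙 ((toℕ i <ᵇ toℕ j) ∧ adj G i j)
    E : ℕ
    E = ∑[ i < n ] ∑[ j < n ] e i j
    edges≡E : edges G ≡ E
    edges≡E = trans (sumFin≡sum (λ i → sumFin (e i))) (sum-cong-≗ {n} (λ i → sumFin≡sum (e i)))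

  degree²-sum : ∑[ x < n ] (degree x * degree x) ≡ ∑[ u < n ] ∑[ v < n ] codegree u v
  degree²-sum = begin
    ∑[ x < n ] (degree x * degree x)
      ≡⟨ sum-cong-≗ {n} (λ x → *-sum-sum (a x) (a x)) ⟩
    ∑[ x < n ] ∑[ u < n ] ∑[ v < n ] (a x u * a x v)
      ≡⟨ ∑-comm (λ x u → ∑[ v < n ] (a x u * a x v)) ⟩
    ∑[ u < n ] ∑[ x < n ] ∑[ v < n ] (a x u * a x v)
      ≡⟨ sum-cong-≗ {n} (λ u → ∑-comm (λ x v → a x u * a x v)) ⟩
    ∑[ u < n ] ∑[ v < n ] ∑[ x < n ] (a x u * a x v)
      ≡⟨ sum-cong-≗ {n} (λ u → sum-cong-≗ {n} (λ v → sum-cong-≗ {n} (common u v))) ⟩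
    ∑[ u < n ] ∑[ v < n ] codegree u v
      ∎
    where
    open ≡-Reasoning
    a : Fin n → Fin n → ℕ
    a x u = 𝟙 (adj G x u)
    common : ∀ u v x → a x u * a x v ≡ 𝟙 (adj G u x ∧ adj G v x)
    common u v x rewrite adj-sym G x u | adj-sym G x v = sym (𝟙-∧ (adj G u x) (adj G v x))

  Consecutive : ∀ {ℓ} → (Fin ℓ → Fin n) → Set
  Consecutive f = ∀ i j → suc (toℕ i) ≡ toℕ j → f i ~ f j

  ∷-consecutive : ∀ {ℓ x} {f : Fin (suc ℓ) → Fin n} → x ~ f Fin.zero → Consecutive f → Consecutive (x ∷ f)
  ∷-consecutive x~f₀ f-cons Fin.zero    (Fin.suc Fin.zero) refl = x~f₀
  ∷-consecutive x~f₀ f-cons (Fin.suc i) (Fin.suc j)        eq   = f-cons i j (suc-injective eq)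

  record Path (ℓ : ℕ) : Set where
    field
      vertex      : Fin ℓ → Fin n
      injective   : Injective _≡_ _≡_ vertex
      consecutive : Consecutive vertex

  PathIn : (Fin n → Bool) → ℕ → Set
  PathIn W ℓ = Σ[ P ∈ Path ℓ ] (∀ i → T (W (Path.vertex P i)))

  [_]ₚ : Fin n → Path 1
  [ w ]ₚ = record
    { vertex      = λ _ → w
    ; injective   = λ { {Fin.zero} {Fin.zero} _ → refl }
    ; consecutive = λ { Fin.zero Fin.zero () }
    }

  prepend : ∀ {ℓ} x (P : Path (suc ℓ)) → x ~ Path.vertex P Fin.zero → (∀ i → Path.vertex P i ≢ x) →
            Path (suc (suc ℓ))
  prepend x P x~head x∉P = record
    { vertex      = x ∷ vertex
    ; injective   = ∷-injective x∉P injective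
    ; consecutive = ∷-consecutive x~head consecutive
    }
    where open Path P

  tailₚ : ∀ {ℓ} → Path (suc ℓ) → Path ℓ
  tailₚ P = record
    { vertex      = vertex ∘ Fin.suc
    ; injective   = Finₚ.suc-injective ∘ injective
    ; consecutive = λ i j eq → consecutive (Fin.suc i) (Fin.suc j) (cong suc eq)
    }
    where open Path P

  closed-path⇒cycle : ∀ {ℓ} (P : Path (suc ℓ)) → Path.vertex P Fin.zero ~ Path.vertex P (Fin.fromℕ ℓ) →
                      ContainsSubgraph (cycAdj (suc ℓ)) G
  closed-path⇒cycle {ℓ} P closing = vertex , injective , edge
    where
    open Path P
    close : ∀ i j → T (toℕ i ≡ᵇ 0) → T (suc (toℕ j) ≡ᵇ suc ℓ) → vertex i ~ vertex j
    close Fin.zero j _ j-last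
      rewrite toℕ-injective (trans (≡ᵇ⇒≡ (toℕ j) ℓ j-last) (sym (toℕ-fromℕ ℓ))) = closing
    edge : ∀ i j → T (cycAdj (suc ℓ) i j) → vertex i ~ vertex j
    edge i j c with Equivalence.to T-∨ c
    ... | inj₁ i→j = consecutive i j (≡ᵇ⇒≡ _ _ i→j)
    ... | inj₂ c′ with Equivalence.to T-∨ c′
    ...   | inj₁ j→i = ~-sym (consecutive j i (≡ᵇ⇒≡ _ _ j→i))
    ...   | inj₂ c″ with Equivalence.to T-∨ c″
    ...     | inj₁ i,j = uncurry (close i j) (Equivalence.to T-∧ i,j)
    ...     | inj₂ j,i = ~-sym (uncurry (close j i) (Equivalence.to T-∧ j,i))

  head-degreeIn≤ : ∀ {W ℓ} (P : Path (suc ℓ)) →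
                   (∀ {x} → T ((W ∩ adj G (Path.vertex P Fin.zero)) x) → ∃[ i ] Path.vertex P i ≡ x) →
                   degreeIn W (Path.vertex P Fin.zero) ≤ ℓ
  head-degreeIn≤ {W} P on-path = ∣∣≤image (W ∩ adj G (vertex Fin.zero)) (vertex ∘ Fin.suc) on-tail
    where
    open Path P
    on-tail : ∀ {x} → T ((W ∩ adj G (vertex Fin.zero)) x) → ∃[ i ] vertex (Fin.suc i) ≡ x
    on-tail x∈N with on-path x∈N
    ... | Fin.zero  , refl = ⊥-elim (~-irrefl (T-∧ʳ x∈N))
    ... | Fin.suc i , eq   = i , eq

  extend-or-sparse : ∀ {W d ℓ} → ℓ ≤ d → ((P , _) : PathIn W (suc ℓ)) →
                     degreeIn W (Path.vertex P Fin.zero) ≤ d ⊎ PathIn W (suc (suc ℓ))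
  extend-or-sparse {W} ℓ≤d (P , P⊆W)
    with Finₚ.any? (λ x → T? ((W ∩ adj G (Path.vertex P Fin.zero)) x) ×-dec ¬? (Finₚ.any? (λ i → Path.vertex P i ≟ x)))
  ... | yes (x , x∈N , x∉P) = inj₂ (prepend x P (~-sym (T-∧ʳ x∈N)) (λ i eq → x∉P (i , eq)) , x∷P⊆W)
    where
    x∷P⊆W : ∀ i → T (W ((x ∷ Path.vertex P) i))
    x∷P⊆W Fin.zero    = T-∧ˡ x∈N
    x∷P⊆W (Fin.suc i) = P⊆W i
  ... | no  none = inj₁ (≤-trans (head-degreeIn≤ P on-path) ℓ≤d)
    where
    on-path : ∀ {x} → T ((W ∩ adj G (Path.vertex P Fin.zero)) x) → ∃[ i ] Path.vertex P i ≡ x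
    on-path {x} x∈N with Finₚ.any? (λ i → Path.vertex P i ≟ x)
    ... | yes x∈P = x∈P
    ... | no  x∉P = ⊥-elim (none (x , x∈N , x∉P))

  sparse-or-path : ∀ {W d w₀} → T (W w₀) → ∀ ℓ → ℓ ≤ suc d →
                   (∃[ w ] T (W w) × degreeIn W w ≤ d) ⊎ PathIn W (suc ℓ)
  sparse-or-path w₀∈W zero    _    = inj₂ ([ _ ]ₚ , λ _ → w₀∈W)
  sparse-or-path w₀∈W (suc ℓ) ℓ<1+d with sparse-or-path w₀∈W ℓ (<⇒≤ ℓ<1+d)
  ... | inj₁ sparse = inj₁ sparse
  ... | inj₂ P with extend-or-sparse (≤-pred ℓ<1+d) P
  ...   | inj₁ sparse = inj₁ (_ , proj₂ P Fin.zero , sparse)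
  ...   | inj₂ longer = inj₂ longer

  Degenerate : ℕ → (Fin n → Bool) → Set
  Degenerate d S = ∀ W → W ⊆ S → 0 < ∣ W ∣ → ∃[ w ] T (W w) × degreeIn W w ≤ d

  pathFree⇒degenerate : ∀ d S → ¬ PathIn S (2 + d) → Degenerate d S
  pathFree⇒degenerate d S no-path W W⊆S 0<∣W∣ with ∣∣>0⇒nonempty W 0<∣W∣
  ... | w₀ , w₀∈W with sparse-or-path w₀∈W (suc d) ≤-refl
  ...   | inj₁ sparse   = sparse
  ...   | inj₂ (P , P⊆W) = ⊥-elim (no-path (P , W⊆S ∘ P⊆W))

  degreeSumIn : (Fin n → Bool) → ℕ
  degreeSumIn W = ∑[ v < n ] ∑[ i < n ] 𝟙 (W v ∧ (W i ∧ adj G v i))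

  degreeSumIn≤ : ∀ W → degreeSumIn W ≤ n * ∣ W ∣
  degreeSumIn≤ W = begin
    degreeSumIn W                     ≤⟨ sum-mono-≤ {n} (λ v → sum-mono-≤ {n} (λ i → 𝟙-∧≤ˡ (W v) _)) ⟩
    ∑[ v < n ] ∑[ i < n ] 𝟙 (W v)     ≡⟨ sum-cong-≗ {n} (λ v → sum-const n (𝟙 (W v))) ⟩
    ∑[ v < n ] (n * 𝟙 (W v))          ≡⟨ *-distribˡ-sum n (𝟙 ∘ W) ⟨
    n * ∣ W ∣                         ∎
    where open ≤-Reasoning

  degreeSumIn-remove : ∀ W w → degreeSumIn W ≤ degreeSumIn (W ─ w) + (degreeIn W w + degreeIn W w)
  degreeSumIn-remove W w = begin
    degreeSumIn W                                                ≤⟨ sum-mono-≤ {n} (λ v → sum-mono-≤ {n} (split v)) ⟩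
    ∑[ v < n ] ∑[ i < n ] (r v i + (a v i + b v i))              ≡⟨ ∑∑-distrib-+ r (λ v i → a v i + b v i) ⟩
    degreeSumIn (W ─ w) + ∑[ v < n ] ∑[ i < n ] (a v i + b v i)  ≡⟨ cong (degreeSumIn (W ─ w) +_) (∑∑-distrib-+ a b) ⟩
    degreeSumIn (W ─ w) + (∑[ v < n ] ∑[ i < n ] a v i + ∑[ v < n ] ∑[ i < n ] b v i)
                                                                 ≡⟨ cong (degreeSumIn (W ─ w) +_) (cong₂ _+_ sum-a sum-b) ⟩
    degreeSumIn (W ─ w) + (degreeIn W w + degreeIn W w)          ∎
    where
    open ≤-Reasoning
    δ : Fin n → ℕ
    δ x = 𝟙 (does (x ≟ w))
    r a b : Fin n → Fin n → ℕ
    r v i = 𝟙 ((W ─ w) v ∧ ((W ─ w) i ∧ adj G v i))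
    a v i = δ v * 𝟙 (W i ∧ adj G v i)
    b v i = δ i * 𝟙 (W v ∧ adj G v i)
    split : ∀ v i → 𝟙 (W v ∧ (W i ∧ adj G v i)) ≤ r v i + (a v i + b v i)
    split v i = 𝟙-remove-≤ (W v) (W i) (adj G v i) (does (v ≟ w)) (does (i ≟ w))
    sum-a : ∑[ v < n ] ∑[ i < n ] a v i ≡ degreeIn W w
    sum-a = trans (sum-cong-≗ {n} (λ v → sym (*-distribˡ-sum (δ v) (λ i → 𝟙 (W i ∧ adj G v i)))))
                  (sum-δ w (degreeIn W))
    sum-b : ∑[ v < n ] ∑[ i < n ] b v i ≡ degreeIn W w
    sum-b = sum-cong-≗ {n} (λ v → trans (sum-δ w (λ i → 𝟙 (W v ∧ adj G v i)))
                                       (cong (λ x → 𝟙 (W v ∧ x)) (adj-sym G v w)))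

  degenerate⇒degreeSumIn≤ : ∀ {d S} → Degenerate d S → ∀ {W} → W ⊆ S → degreeSumIn W ≤ (d + d) * ∣ W ∣
  degenerate⇒degreeSumIn≤ {d} {S} degenerate {W} W⊆S = go ∣ W ∣ W W⊆S ≤-refl
    where
    go : ∀ m W → W ⊆ S → ∣ W ∣ ≤ m → degreeSumIn W ≤ (d + d) * m
    go m W W⊆S ∣W∣≤m with ∣ W ∣ ℕ.≟ 0
    ... | yes empty = ≤-trans (degreeSumIn≤ W) (≤-trans (≤-reflexive (trans (cong (n *_) empty) (*-zeroʳ n))) z≤n)
    go zero    W W⊆S ∣W∣≤0   | no nonempty = ⊥-elim (nonempty (n≤0⇒n≡0 ∣W∣≤0))
    go (suc m) W W⊆S ∣W∣≤1+m | no nonempty with degenerate W W⊆S (n≢0⇒n>0 nonempty)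
    ... | w , w∈W , sparse = begin
      degreeSumIn W
        ≤⟨ degreeSumIn-remove W w ⟩
      degreeSumIn (W ─ w) + (degreeIn W w + degreeIn W w)
        ≤⟨ +-mono-≤ (go m (W ─ w) (W⊆S ∘ T-∧ʳ) smaller) (+-mono-≤ sparse sparse) ⟩
      (d + d) * m + (d + d)
        ≡⟨ trans (+-comm _ (d + d)) (sym (*-suc (d + d) m)) ⟩
      (d + d) * suc m
        ∎
      where
      open ≤-Reasoning
      smaller : ∣ W ─ w ∣ ≤ m
      smaller = ≤-pred (subst (_≤ suc m) (∣∣-remove W w∈W) ∣W∣≤1+m)

  infixl 6 _∖N[_]
  _∖N[_] : (Fin n → Bool) → Fin n → Fin n → Bool
  (W ∖N[ w ]) i = not (adj G w i) ∧ (W ─ w) i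

  ∖N-⊆ : ∀ {W w} → W ∖N[ w ] ⊆ W
  ∖N-⊆ {W} {w} {i} = T-∧ʳ {not (does (i ≟ w))} ∘ T-∧ʳ {not (adj G w i)}

  ∖N-≢ : ∀ {W w i} → T ((W ∖N[ w ]) i) → i ≢ w
  ∖N-≢ {W} {w} i∈W∖N refl =
    subst (T ∘ not) (dec-true (w ≟ w) refl) (T-∧ˡ {not (does (w ≟ w))} (T-∧ʳ {not (adj G w w)} i∈W∖N))

  ∖N-≁ : ∀ {W w i} → T ((W ∖N[ w ]) i) → adj G w i ≡ false
  ∖N-≁ {W} {w} {i} = Equivalence.to T-not-≡ ∘ T-∧ˡ {not (adj G w i)}

  ∣∣-∖N : ∀ W {w} → T (W w) → ∣ W ∣ ≤ suc (∣ W ∖N[ w ] ∣ + degreeIn W w)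
  ∣∣-∖N W {w} w∈W = begin
    ∣ W ∣
      ≡⟨ ∣∣-remove W w∈W ⟩
    suc ∣ W ─ w ∣
      ≤⟨ s≤s (sum-mono-≤ {n} split) ⟩
    suc (∑[ i < n ] (𝟙 ((W ∖N[ w ]) i) + 𝟙 (W i ∧ adj G w i)))
      ≡⟨ cong suc (∑-distrib-+ (𝟙 ∘ (W ∖N[ w ])) (λ i → 𝟙 (W i ∧ adj G w i))) ⟩
    suc (∣ W ∖N[ w ] ∣ + degreeIn W w)
      ∎
    where
    open ≤-Reasoning
    split : ∀ i → 𝟙 ((W ─ w) i) ≤ 𝟙 ((W ∖N[ w ]) i) + 𝟙 (W i ∧ adj G w i)
    split i = 𝟙-split-≤ (not (does (i ≟ w))) (W i) (adj G w i)

  record IndependentSet (W : Fin n → Bool) (j : ℕ) : Set where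
    field
      member      : Fin j → Fin n
      injective   : Injective _≡_ _≡_ member
      inside      : ∀ a → T (W (member a))
      independent : ∀ a b → adj G (member a) (member b) ≡ false

  -- The size condition reads ∣ W ∣ > (d + 1)(j − 1) without truncated subtraction.
  degenerate⇒independentSet : ∀ {d S} → Degenerate d S → ∀ j {W} → W ⊆ S → suc d * j ≤ ∣ W ∣ + d →
                              IndependentSet W j
  degenerate⇒independentSet _ zero _ _ = record
    { member = [] ; injective = λ { {()} } ; inside = λ () ; independent = λ () }
  degenerate⇒independentSet {d} degenerate (suc j) {W} W⊆S large
    with degenerate W W⊆S (+-cancelʳ-≤ d 1 ∣ W ∣ (≤-trans (m≤m*n (suc d) (suc j)) large))
  ... | w , w∈W , sparse = record
    { member      = w ∷ member
    ; injective   = ∷-injective (∖N-≢ {W} ∘ inside) injective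
    ; inside      = λ { Fin.zero → w∈W ; (Fin.suc a) → ∖N-⊆ {W} (inside a) }
    ; independent = λ
        { Fin.zero    Fin.zero    → adj-irrefl G w
        ; Fin.zero    (Fin.suc b) → ∖N-≁ {W} (inside b)
        ; (Fin.suc a) Fin.zero    → trans (adj-sym G _ w) (∖N-≁ {W} (inside a))
        ; (Fin.suc a) (Fin.suc b) → independent a b
        }
    }
    where
    large′ : suc d * j ≤ ∣ W ∖N[ w ] ∣ + d
    large′ = +-cancelˡ-≤ (suc d) _ _ (begin
      suc d + suc d * j               ≡⟨ *-suc (suc d) j ⟨
      suc d * suc j                   ≤⟨ large ⟩
      ∣ W ∣ + d                       ≤⟨ +-monoˡ-≤ d (≤-trans (∣∣-∖N W w∈W) (s≤s (+-monoʳ-≤ _ sparse))) ⟩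
      suc (∣ W ∖N[ w ] ∣ + d) + d     ≡⟨ shuffle ∣ W ∖N[ w ] ∣ d ⟩
      suc d + (∣ W ∖N[ w ] ∣ + d)     ∎)
      where
      open ≤-Reasoning
      shuffle : ∀ a d → suc (a + d) + d ≡ suc d + (a + d)
      shuffle = solve-∀
    open IndependentSet (degenerate⇒independentSet degenerate j (W⊆S ∘ ∖N-⊆ {W}) large′)

  independent-common-neighbours⇒K₂,ₜ : ∀ {t u v} → u ≢ v → adj G u v ≡ false →
                                       IndependentSet (adj G u ∩ adj G v) t → ContainsInduced (bipAdj t) G
  independent-common-neighbours⇒K₂,ₜ {t} {u} {v} u≢v u≁v I =
    u ∷ v ∷ member , ∷-injective u∉ (∷-injective v∉ injective) , adjacency
    where
    open IndependentSet I
    u~ : ∀ a → u ~ member a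
    u~ a = T-∧ˡ (inside a)
    v~ : ∀ a → v ~ member a
    v~ a = T-∧ʳ (inside a)
    v∉ : ∀ a → member a ≢ v
    v∉ a eq = ~⇒≢ (v~ a) (sym eq)
    u∉ : ∀ a → (v ∷ member) a ≢ u
    u∉ Fin.zero    eq = u≢v (sym eq)
    u∉ (Fin.suc a) eq = ~⇒≢ (u~ a) (sym eq)
    adjacency : ∀ a b → adj G ((u ∷ v ∷ member) a) ((u ∷ v ∷ member) b) ≡ bipAdj t a b
    adjacency Fin.zero                 Fin.zero                 = adj-irrefl G u
    adjacency Fin.zero                 (Fin.suc Fin.zero)       = u≁v
    adjacency Fin.zero                 (Fin.suc (Fin.suc b))    = Equivalence.to T-≡ (u~ b)
    adjacency (Fin.suc Fin.zero)       Fin.zero                 = trans (adj-sym G v u) u≁v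
    adjacency (Fin.suc Fin.zero)       (Fin.suc Fin.zero)       = adj-irrefl G v
    adjacency (Fin.suc Fin.zero)       (Fin.suc (Fin.suc b))    = Equivalence.to T-≡ (v~ b)
    adjacency (Fin.suc (Fin.suc a))    Fin.zero                 = Equivalence.to T-≡ (~-sym (u~ a))
    adjacency (Fin.suc (Fin.suc a))    (Fin.suc Fin.zero)       = Equivalence.to T-≡ (~-sym (v~ a))
    adjacency (Fin.suc (Fin.suc a))    (Fin.suc (Fin.suc b))    = independent a b

  neighbourhood-pathFree : ∀ {d} → ¬ ContainsSubgraph (cycAdj (3 + d)) G → ∀ u → ¬ PathIn (adj G u) (2 + d)
  neighbourhood-pathFree {d} no-cycle u (P , P⊆N) =
    no-cycle (closed-path⇒cycle (prepend u P (P⊆N Fin.zero) u∉P) (P⊆N (Fin.fromℕ (suc d))))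
    where
    u∉P : ∀ i → Path.vertex P i ≢ u
    u∉P i eq = ~⇒≢ (P⊆N i) (sym eq)

  common-neighbourhood-pathFree : ∀ {d} → ¬ ContainsSubgraph (cycAdj (4 + d)) G →
                                  ∀ {u v} → u ≢ v → ¬ PathIn (adj G u ∩ adj G v) (2 + d)
  common-neighbourhood-pathFree {d} no-cycle {u} {v} u≢v (Q , Q⊆S) =
    -- the cycle v q₀ u q₁ … q_{d+1}
    no-cycle (closed-path⇒cycle (prepend v (prepend q₀ (prepend u (tailₚ Q) (u~ (Fin.suc Fin.zero)) u∉)
                                                        (~-sym (u~ Fin.zero)) q₀∉)
                                          (v~ Fin.zero) v∉)
                                (v~ (Fin.suc (Fin.fromℕ d))))
    where
    open Path Q
    q₀ : Fin n
    q₀ = vertex Fin.zero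
    u~ : ∀ i → u ~ vertex i
    u~ i = T-∧ˡ (Q⊆S i)
    v~ : ∀ i → v ~ vertex i
    v~ i = T-∧ʳ (Q⊆S i)
    u∉ : ∀ i → vertex (Fin.suc i) ≢ u
    u∉ i eq = ~⇒≢ (u~ (Fin.suc i)) (sym eq)
    q₀∉ : ∀ i → (u ∷ vertex ∘ Fin.suc) i ≢ q₀
    q₀∉ Fin.zero    = ~⇒≢ (u~ Fin.zero)
    q₀∉ (Fin.suc i) eq with injective eq
    ... | ()
    v∉ : ∀ i → (q₀ ∷ u ∷ vertex ∘ Fin.suc) i ≢ v
    v∉ Fin.zero           eq = ~⇒≢ (v~ Fin.zero) (sym eq)
    v∉ (Fin.suc Fin.zero) eq = u≢v eq
    v∉ (Fin.suc (Fin.suc i)) eq = ~⇒≢ (v~ (Fin.suc i)) (sym eq)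

  nonadjacent-codegree≤ : ∀ {d t} → ¬ ContainsSubgraph (cycAdj (4 + d)) G → ¬ ContainsInduced (bipAdj (suc t)) G →
              ∀ {u v} → u ≢ v → adj G u v ≡ false → codegree u v ≤ suc d * t
  nonadjacent-codegree≤ {d} {t} no-cycle no-K₂,ₜ {u} {v} u≢v u≁v with codegree u v ≤? suc d * t
  ... | yes small = small
  ... | no  big   = ⊥-elim (no-K₂,ₜ (independent-common-neighbours⇒K₂,ₜ u≢v u≁v
                      (degenerate⇒independentSet degenerate (suc t) (λ i∈S → i∈S) large)))
    where
    degenerate : Degenerate d (adj G u ∩ adj G v)
    degenerate = pathFree⇒degenerate d (adj G u ∩ adj G v) (common-neighbourhood-pathFree no-cycle u≢v)
    large : suc d * suc t ≤ codegree u v + d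
    large = begin
      suc d * suc t            ≡⟨ *-suc (suc d) t ⟩
      suc d + suc d * t        ≡⟨ +-suc d (suc d * t) ⟨
      d + suc (suc d * t)      ≤⟨ +-monoʳ-≤ d (≰⇒> big) ⟩
      d + codegree u v         ≡⟨ +-comm d _ ⟩
      codegree u v + d         ∎
      where open ≤-Reasoning

  neighbourhood-degreeSum≤ : ∀ {d} → ¬ ContainsSubgraph (cycAdj (3 + d)) G →
                             ∀ u → degreeSumIn (adj G u) ≤ (d + d) * degree u
  neighbourhood-degreeSum≤ {d} no-cycle u =
    degenerate⇒degreeSumIn≤ (pathFree⇒degenerate d (adj G u) (neighbourhood-pathFree no-cycle u)) (λ i∈N → i∈N)

  codegree-row≤ : ∀ {m} → (∀ {u v} → u ≢ v → adj G u v ≡ false → codegree u v ≤ m) →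
                  ∀ u → ∑[ v < n ] codegree u v ≤ degree u + (degreeSumIn (adj G u) + n * m)
  codegree-row≤ {m} nonadjacent≤ u = begin
    ∑[ v < n ] codegree u v                           ≤⟨ sum-mono-≤ {n} split ⟩
    ∑[ v < n ] (δ v * codegree u v + (B v + m))       ≡⟨ ∑-distrib-+ (λ v → δ v * codegree u v) (λ v → B v + m) ⟩
    ∑[ v < n ] (δ v * codegree u v) + ∑[ v < n ] (B v + m) ≡⟨ cong₂ _+_ diagonal (∑-distrib-+ B (λ _ → m)) ⟩
    degree u + (degreeSumIn (adj G u) + ∑[ v < n ] m) ≡⟨ cong (λ x → degree u + (degreeSumIn (adj G u) + x)) (sum-const n m) ⟩
    degree u + (degreeSumIn (adj G u) + n * m)        ∎
    where
    open ≤-Reasoning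
    δ : Fin n → ℕ
    δ v = 𝟙 (does (v ≟ u))
    B : Fin n → ℕ
    B v = ∑[ i < n ] 𝟙 (adj G u v ∧ (adj G u i ∧ adj G v i))
    diagonal : ∑[ v < n ] (δ v * codegree u v) ≡ degree u
    diagonal = trans (sum-δ u (codegree u)) (sum-cong-≗ {n} (λ i → cong 𝟙 (∧-idem (adj G u i))))
    split : ∀ v → codegree u v ≤ δ v * codegree u v + (B v + m)
    split v with v ≟ u
    ... | yes refl = ≤-trans (≤-reflexive (sym (*-identityˡ _))) (m≤m+n _ _)
    ... | no  v≢u with adj G u v in u~v
    ...   | true  = m≤m+n _ m
    ...   | false = ≤-trans (nonadjacent≤ (v≢u ∘ sym) u~v) (m≤n+m m _)

  degree-sum²≤ : ∀ {m c} → (∀ {u v} → u ≢ v → adj G u v ≡ false → codegree u v ≤ m) →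
                 (∀ u → degreeSumIn (adj G u) ≤ c * degree u) →
                 (∑[ v < n ] degree v) * (∑[ v < n ] degree v) ≤ n * (suc c * ∑[ v < n ] degree v + n * (n * m))
  degree-sum²≤ {m} {c} nonadjacent≤ neighbourhood≤ = begin
    D * D                                          ≤⟨ sum-square≤ degree ⟩
    n * ∑[ x < n ] (degree x * degree x)           ≡⟨ cong (n *_) degree²-sum ⟩
    n * ∑[ u < n ] ∑[ v < n ] codegree u v         ≤⟨ *-monoʳ-≤ n (sum-mono-≤ {n} row≤) ⟩
    n * ∑[ u < n ] (suc c * degree u + n * m)      ≡⟨ cong (n *_) (∑-distrib-+ (λ u → suc c * degree u) (λ _ → n * m)) ⟩
    n * (∑[ u < n ] (suc c * degree u) + ∑[ u < n ] (n * m))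
      ≡⟨ cong (n *_) (cong₂ _+_ (*-distribˡ-sum (suc c) degree) (sym (sum-const n (n * m)))) ⟨
    n * (suc c * D + n * (n * m))                  ∎
    where
    open ≤-Reasoning
    D : ℕ
    D = ∑[ v < n ] degree v
    row≤ : ∀ u → ∑[ v < n ] codegree u v ≤ suc c * degree u + n * m
    row≤ u = ≤-trans (codegree-row≤ nonadjacent≤ u)
                     (≤-trans (+-monoʳ-≤ (degree u) (+-monoˡ-≤ (n * m) (neighbourhood≤ u)))
                              (≤-reflexive (sym (+-assoc (degree u) (c * degree u) (n * m)))))

  edges²≤ : ∀ {d t} → ¬ ContainsSubgraph (cycAdj (4 + d)) G → ¬ ContainsInduced (bipAdj (suc t)) G →
            (2 * edges G) * (2 * edges G) ≤ n * (suc (suc d + suc d) * (2 * edges G) + n * (n * (suc d * t)))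
  edges²≤ {d} {t} no-cycle no-K₂,ₜ =
    subst (λ D → D * D ≤ n * (suc (suc d + suc d) * D + n * (n * (suc d * t)))) degree-sum
          (degree-sum²≤ {suc d * t} {suc d + suc d} (nonadjacent-codegree≤ no-cycle no-K₂,ₜ)
                                                     (neighbourhood-degreeSum≤ no-cycle))

ℕ→ℚ≡mkℚ : ∀ a → ℕ→ℚ a ≡ mkℚ (ℤ.+ a) 0 (Coprime.sym (1-coprimeTo a))
ℕ→ℚ≡mkℚ a = ℚₚ.normalize-coprime (Coprime.sym (1-coprimeTo a))

ℕ→ℚ-+ : ∀ a b → ℕ→ℚ (a + b) ≡ ℕ→ℚ a ℚ.+ ℕ→ℚ b
ℕ→ℚ-+ a b rewrite ℕ→ℚ≡mkℚ a | ℕ→ℚ≡mkℚ b =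
  cong (ℚ._/ 1) (sym (cong₂ ℤ._+_ (ℤₚ.*-identityʳ (ℤ.+ a)) (ℤₚ.*-identityʳ (ℤ.+ b))))

ℕ→ℚ-* : ∀ a b → ℕ→ℚ (a * b) ≡ ℕ→ℚ a ℚ.* ℕ→ℚ b
ℕ→ℚ-* a b rewrite ℕ→ℚ≡mkℚ a | ℕ→ℚ≡mkℚ b = cong (ℚ._/ 1) (ℤₚ.pos-* a b)

ℕ→ℚ-^ : ∀ a j → ℕ→ℚ (a ^ j) ≡ ℕ→ℚ a ^ℚ j
ℕ→ℚ-^ a zero    = refl
ℕ→ℚ-^ a (suc j) = trans (ℕ→ℚ-* a (a ^ j)) (cong (ℕ→ℚ a ℚ.*_) (ℕ→ℚ-^ a j))

ℕ→ℚ-mono-≤ : ∀ {a b} → a ≤ b → ℕ→ℚ a ℚ.≤ ℕ→ℚ b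
ℕ→ℚ-mono-≤ {a} {b} a≤b rewrite ℕ→ℚ≡mkℚ a | ℕ→ℚ≡mkℚ b =
  ℚ.*≤* (subst₂ ℤ._≤_ (sym (ℤₚ.*-identityʳ (ℤ.+ a))) (sym (ℤₚ.*-identityʳ (ℤ.+ b))) (ℤ.+≤+ a≤b))

ℕ→ℚ-cancel-< : ∀ {a b} → ℕ→ℚ a ℚ.< ℕ→ℚ b → a < b
ℕ→ℚ-cancel-< a<b = ≰⇒> (λ b≤a → ℚₚ.<-irrefl refl (ℚₚ.<-≤-trans a<b (ℕ→ℚ-mono-≤ b≤a)))

*-mono-≤-nonNeg : ∀ {p q r s} → 0ℚ ℚ.≤ p → 0ℚ ℚ.≤ r → p ℚ.≤ q → r ℚ.≤ s → p ℚ.* r ℚ.≤ q ℚ.* s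
*-mono-≤-nonNeg {p} {q} {r} {s} 0≤p 0≤r p≤q r≤s =
  ℚₚ.≤-trans (ℚₚ.*-monoʳ-≤-nonNeg r {{ℚ.nonNegative 0≤r}} p≤q)
             (ℚₚ.*-monoˡ-≤-nonNeg q {{ℚ.nonNegative (ℚₚ.≤-trans 0≤p p≤q)}} r≤s)

^ℚ-nonNeg : ∀ {p} j → 0ℚ ℚ.≤ p → 0ℚ ℚ.≤ p ^ℚ j
^ℚ-nonNeg zero    _   = ℚₚ.nonNegative⁻¹ ℚ.1ℚ
^ℚ-nonNeg {p} (suc j) 0≤p = subst (ℚ._≤ p ℚ.* p ^ℚ j) (ℚₚ.*-zeroˡ (p ^ℚ j))
  (ℚₚ.*-monoʳ-≤-nonNeg (p ^ℚ j) {{ℚ.nonNegative (^ℚ-nonNeg j 0≤p)}} 0≤p)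

^ℚ-mono-≤ : ∀ {p q} j → 0ℚ ℚ.≤ p → p ℚ.≤ q → p ^ℚ j ℚ.≤ q ^ℚ j
^ℚ-mono-≤ zero    _   _   = ℚₚ.≤-refl
^ℚ-mono-≤ (suc j) 0≤p p≤q = *-mono-≤-nonNeg 0≤p (^ℚ-nonNeg j 0≤p) p≤q (^ℚ-mono-≤ j 0≤p p≤q)

^ℚ-cancel-< : ∀ {p q} j → 0ℚ ℚ.≤ q → p ^ℚ j ℚ.< q ^ℚ j → p ℚ.< q
^ℚ-cancel-< j 0≤q pʲ<qʲ =
  ℚₚ.≰⇒> (λ q≤p → ℚₚ.<-irrefl refl (ℚₚ.<-≤-trans pʲ<qʲ (^ℚ-mono-≤ j 0≤q q≤p)))

<-root : ∀ {b} a y j → a ^ j ≤ b → 0ℚ ℚ.≤ y → ℕ→ℚ b ℚ.< y ^ℚ j → ℕ→ℚ a ℚ.< y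
<-root {b} a y j aʲ≤b 0≤y b<yʲ =
  ^ℚ-cancel-< j 0≤y (ℚₚ.≤-<-trans (subst (ℚ._≤ ℕ→ℚ b) (ℕ→ℚ-^ a j) (ℕ→ℚ-mono-≤ aʲ≤b)) b<yʲ)

module _ where
  open +-*-Solver

  <-‿⇒+< : ∀ {p q r} → p ℚ.< q ℚ.- r → p ℚ.+ r ℚ.< q
  <-‿⇒+< {p} {q} {r} p<q-r =
    subst (p ℚ.+ r ℚ.<_) (solve 2 (λ q r → (q :- r) :+ r := q) refl q r) (ℚₚ.+-monoˡ-< r p<q-r)

  +<⇒<-‿ : ∀ {p q r} → p ℚ.+ r ℚ.< q → p ℚ.< q ℚ.- r
  +<⇒<-‿ {p} {q} {r} p+r<q =
    subst (ℚ._< q ℚ.- r) (solve 2 (λ p r → (p :+ r) :- r := p) refl p r) (ℚₚ.+-monoˡ-< (ℚ.- r) p+r<q)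

  ℕ→ℚ-∸ : ∀ {a b} → b ≤ a → ℕ→ℚ (a ∸ b) ≡ ℕ→ℚ a ℚ.- ℕ→ℚ b
  ℕ→ℚ-∸ {a} {b} b≤a = begin
    ℕ→ℚ (a ∸ b)
      ≡⟨ solve 2 (λ x y → x := (x :+ y) :- y) refl (ℕ→ℚ (a ∸ b)) (ℕ→ℚ b) ⟩
    ℕ→ℚ (a ∸ b) ℚ.+ ℕ→ℚ b ℚ.- ℕ→ℚ b
      ≡⟨ cong (ℚ._- ℕ→ℚ b) (trans (sym (ℕ→ℚ-+ (a ∸ b) b)) (cong ℕ→ℚ (m∸n+n≡m b≤a))) ⟩
    ℕ→ℚ a ℚ.- ℕ→ℚ b
      ∎
    where open ≡-Reasoning

p≤p+q : ∀ {p q} → 0ℚ ℚ.≤ q → p ℚ.≤ p ℚ.+ q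
p≤p+q {p} 0≤q = ℚₚ.≤-trans (ℚₚ.≤-reflexive (sym (ℚₚ.+-identityʳ p))) (ℚₚ.+-monoʳ-≤ p 0≤q)

^-distribʳ-* : ∀ a b j → (a * b) ^ j ≡ a ^ j * b ^ j
^-distribʳ-* a b zero    = refl
^-distribʳ-* a b (suc j) = trans (cong ((a * b) *_) (^-distribʳ-* a b j)) (swap a b (a ^ j) (b ^ j))
  where
  swap : ∀ a b x y → a * b * (x * y) ≡ a * x * (b * y)
  swap = solve-∀

n^j≤n^[1+j] : ∀ n j → 1 ≤ j → n ^ j ≤ n ^ (1 + j)
n^j≤n^[1+j] zero    (suc j) _ = ≤-refl
n^j≤n^[1+j] (suc n) j       _ = m≤m+n (suc n ^ j) (n * suc n ^ j)

[a*n]^j≤a^j*n^[j+1] : ∀ a n j → 1 ≤ j → (a * n) ^ j ≤ a ^ j * n ^ (j + 1)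
[a*n]^j≤a^j*n^[j+1] a n j 1≤j = begin
  (a * n) ^ j          ≡⟨ ^-distribʳ-* a n j ⟩
  a ^ j * n ^ j        ≤⟨ *-monoʳ-≤ (a ^ j) (n^j≤n^[1+j] n j 1≤j) ⟩
  a ^ j * n ^ (1 + j)  ≡⟨ cong (λ i → a ^ j * n ^ i) (+-comm 1 j) ⟩
  a ^ j * n ^ (j + 1)  ∎
  where open ≤-Reasoning

[[m∸1]*n³]²≤m*[m∸1]*n⁶ : ∀ m n → ((m ∸ 1) * n ^ 3) ^ 2 ≤ m * (m ∸ 1) * n ^ 6
[[m∸1]*n³]²≤m*[m∸1]*n⁶ m n = begin
  ((m ∸ 1) * n ^ 3) ^ 2                ≡⟨ square (m ∸ 1) (n ^ 3) ⟩
  (m ∸ 1) * (m ∸ 1) * (n ^ 3 * n ^ 3)  ≤⟨ *-monoˡ-≤ (n ^ 3 * n ^ 3) (*-monoˡ-≤ (m ∸ 1) (m∸n≤m m 1)) ⟩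
  m * (m ∸ 1) * (n ^ 3 * n ^ 3)        ≡⟨ cong (m * (m ∸ 1) *_) (^-distribˡ-+-* n 3 3) ⟨
  m * (m ∸ 1) * n ^ 6                  ∎
  where
  open ≤-Reasoning
  square : ∀ a x → (a * x) * ((a * x) * 1) ≡ a * a * (x * x)
  square = solve-∀

-- Undoing the squaring and the 2k-th power in ExceedsBound gives β n < e − q and
-- (m − 1) n³ < 4q² − n³; hence s = e − β n exceeds q, and m n³ < 4q² < 4s².
exceedsBound⇒excess : ∀ k t β n e → 1 ≤ k → ExceedsBound k t β n e →
                      ∃[ s ] e ≡ s + β * n × (2 * k ∸ 2) * (t ∸ 1) * n ^ 3 < 4 * s ^ 2
exceedsBound⇒excess k t β n e 1≤k (q , 0<q , 0<D , αn⁶<D² , 0<E-q , β²ᵏn²ᵏ⁺¹<[E-q]²ᵏ) =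
  s , sym (m∸n+n≡m (<⇒≤ βn<e)) , ℕ→ℚ-cancel-< mn³<4s²
  where
  m s : ℕ
  m = (2 * k ∸ 2) * (t ∸ 1)
  s = e ∸ β * n
  E βn D : ℚ
  E = ℕ→ℚ e
  βn = ℕ→ℚ (β * n)
  D = ℕ→ℚ 4 ℚ.* q ^ℚ 2 ℚ.- ℕ→ℚ (n ^ 3)
  βn<E-q : βn ℚ.< E ℚ.- q
  βn<E-q = <-root (β * n) (E ℚ.- q) (2 * k) ([a*n]^j≤a^j*n^[j+1] β n (2 * k) (≤-trans 1≤k (m≤n*m k 2)))
                  (ℚₚ.<⇒≤ 0<E-q) β²ᵏn²ᵏ⁺¹<[E-q]²ᵏ
  βn<e : β * n < e
  βn<e = ℕ→ℚ-cancel-< (ℚₚ.≤-<-trans (p≤p+q (ℚₚ.<⇒≤ 0<q)) (<-‿⇒+< βn<E-q))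
  q<s : q ℚ.< ℕ→ℚ s
  q<s = subst (q ℚ.<_) (sym (ℕ→ℚ-∸ (<⇒≤ βn<e)))
              (+<⇒<-‿ (subst (ℚ._< E) (ℚₚ.+-comm βn q) (<-‿⇒+< βn<E-q)))
  mn³<4q² : ℕ→ℚ (m * n ^ 3) ℚ.< ℕ→ℚ 4 ℚ.* q ^ℚ 2
  mn³<4q² = ℚₚ.≤-<-trans
    (subst (ℕ→ℚ (m * n ^ 3) ℚ.≤_) (ℕ→ℚ-+ ((m ∸ 1) * n ^ 3) (n ^ 3)) (ℕ→ℚ-mono-≤ mn³≤))
    (<-‿⇒+< [m∸1]n³<D)
    where
    mn³≤ : m * n ^ 3 ≤ (m ∸ 1) * n ^ 3 + n ^ 3
    mn³≤ = ≤-trans (*-monoˡ-≤ (n ^ 3) (m≤n+m∸n m 1)) (≤-reflexive (+-comm (n ^ 3) _))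
    [m∸1]n³<D : ℕ→ℚ ((m ∸ 1) * n ^ 3) ℚ.< D
    [m∸1]n³<D = <-root ((m ∸ 1) * n ^ 3) D 2 ([[m∸1]*n³]²≤m*[m∸1]*n⁶ m n) (ℚₚ.<⇒≤ 0<D) αn⁶<D²
  4q²≤4s² : ℕ→ℚ 4 ℚ.* q ^ℚ 2 ℚ.≤ ℕ→ℚ (4 * s ^ 2)
  4q²≤4s² = subst (ℕ→ℚ 4 ℚ.* q ^ℚ 2 ℚ.≤_)
                  (sym (trans (ℕ→ℚ-* 4 (s ^ 2)) (cong (ℕ→ℚ 4 ℚ.*_) (ℕ→ℚ-^ s 2))))
                  (ℚₚ.*-monoˡ-≤-nonNeg (ℕ→ℚ 4) (^ℚ-mono-≤ 2 (ℚₚ.<⇒≤ 0<q) (ℚₚ.<⇒≤ q<s)))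
  mn³<4s² : ℕ→ℚ (m * n ^ 3) ℚ.< ℕ→ℚ (4 * s ^ 2)
  mn³<4s² = ℚₚ.<-≤-trans mn³<4q² 4q²≤4s²

quadratic-bound⇒excess≤ : ∀ β m n s →
                          (2 * (s + β * n)) * (2 * (s + β * n)) ≤ n * (β * (2 * (s + β * n)) + n * (n * m)) →
                          4 * s ^ 2 ≤ m * n ^ 3
quadratic-bound⇒excess≤ β m n s bound = +-cancelʳ-≤ Y (4 * s ^ 2) (m * n ^ 3) (begin
  4 * s ^ 2 + Y                                ≤⟨ m≤m+n _ Z ⟩
  4 * s ^ 2 + Y + Z                            ≡⟨ expand-square β n s ⟩
  (2 * (s + β * n)) * (2 * (s + β * n))        ≤⟨ bound ⟩
  n * (β * (2 * (s + β * n)) + n * (n * m))    ≡⟨ expand-bound β m n s ⟩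
  m * n ^ 3 + Y                                ∎)
  where
  open ≤-Reasoning
  Y Z : ℕ
  Y = 2 * β * s * n + 2 * β * β * (n * n)
  Z = 6 * β * s * n + 2 * β * β * (n * n)
  expand-square : ∀ β n s → 4 * (s * (s * 1)) + (2 * β * s * n + 2 * β * β * (n * n))
                                              + (6 * β * s * n + 2 * β * β * (n * n))
                            ≡ (2 * (s + β * n)) * (2 * (s + β * n))
  expand-square = solve-∀
  expand-bound : ∀ β m n s → n * (β * (2 * (s + β * n)) + n * (n * m))
                             ≡ m * (n * (n * (n * 1))) + (2 * β * s * n + 2 * β * β * (n * n))
  expand-bound = solve-∀

theorem4 : ∀ (k : ℕ) → 2 ≤ k → ∃[ β ] ∀ (t : ℕ) → 2 ≤ t → ∀ (n : ℕ) (G : Graph n) →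
             ¬ ContainsSubgraph (cycAdj (2 * k + 1)) G →
             ¬ ContainsInduced (bipAdj t) G →
             ¬ ExceedsBound k t β n (edges G)
theorem4 k 2≤k = β , bound
  where
  d β : ℕ
  d = 2 * k ∸ 3
  β = suc (suc d + suc d)
  3≤2k : 3 ≤ 2 * k
  3≤2k = ≤-trans (s≤s (s≤s (s≤s z≤n))) (*-monoʳ-≤ 2 2≤k)
  2k≡3+d : 2 * k ≡ 3 + d
  2k≡3+d = sym (m+[n∸m]≡n 3≤2k)
  2k∸2≡1+d : 2 * k ∸ 2 ≡ suc d
  2k∸2≡1+d = cong (_∸ 2) 2k≡3+d
  2k+1≡4+d : 2 * k + 1 ≡ 4 + d
  2k+1≡4+d = trans (cong (_+ 1) 2k≡3+d) (+-comm (3 + d) 1)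
  bound : ∀ t → 2 ≤ t → ∀ n (G : Graph n) → ¬ ContainsSubgraph (cycAdj (2 * k + 1)) G →
          ¬ ContainsInduced (bipAdj t) G → ¬ ExceedsBound k t β n (edges G)
  bound (suc t) _ n G no-cycle no-K₂,ₜ exceeds =
    let s , e≡s+βn , mn³<4s² = exceedsBound⇒excess k (suc t) β n (edges G) (≤-trans (s≤s z≤n) 2≤k) exceeds
    in <⇒≱ (subst (λ x → x * t * n ^ 3 < 4 * s ^ 2) 2k∸2≡1+d mn³<4s²)
           (quadratic-bound⇒excess≤ β (suc d * t) n s
             (subst (λ e → (2 * e) * (2 * e) ≤ n * (β * (2 * e) + n * (n * (suc d * t)))) e≡s+βn
                    (edges²≤ G (subst (λ ℓ → ¬ ContainsSubgraph (cycAdj ℓ) G) 2k+1≡4+d no-cycle) no-K₂,ₜ)))
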